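{- Let $n=pr$ be an odd natural number, where $p,r$ are natural numbers with $p,r\ge 3$. Then there exist distinct integers $x,w$ with $1\le x,w\le \frac{n+1}{2}$ such that $x(n+1-x)\equiv w(n+1-w)\pmod n$. -}

module Defs where

module Submission where

-- For any integers x, w, m we have x(m − x) − w(m − w) = (x − w)(m − x − w).
-- So to make x(n+1−x) ≡ w(n+1−w) (mod n) for n = p·r it suffices to choose x, w
-- with x − w = p and (n + 1) − x − w = r: the difference is then exactly p·r = n.
-- Solving, x = w + p and 2w = n + 1 − p − r = (p − 1)(r − 1), which is even and
-- positive because p, r are odd and at least 3; the bound 2x ≤ n + 1 becomes p ≤ r.

open import Defs
open import Data.Nat using (ℕ; _≤_; _*_; _+_)
open import Data.Nat.Divisibility as ℕD using ()
open import Data.Integer as ℤ using (ℤ; +_)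
open import Data.Integer.Divisibility using (_∣_)
open import Data.Product using (∃₂; _×_)
open import Relation.Binary.PropositionalEquality using (_≡_; _≢_)
open import Relation.Nullary using (¬_)

open import Data.Nat using (zero; suc; s≤s; z≤n; _%_; _/_)
open import Data.Integer using (+≤+)
open import Data.Nat.DivMod using (m≡m%n+[m/n]*n; m%n<n)
import Data.Nat.Properties as ℕP
import Data.Integer.Properties as ℤP
open import Data.Nat.Tactic.RingSolver using () renaming (solve-∀ to ℕ-solve-∀)
open import Data.Integer.Tactic.RingSolver using () renaming (solve-∀ to ℤ-solve-∀)
open import Data.Product using (∃; _,_)
open import Data.Sum using (inj₁; inj₂)
open import Data.Empty using (⊥-elim)
open import Relation.Binary.PropositionalEquality using (refl; sym; trans; cong; cong₂; subst; module ≡-Reasoning)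

Collision : ℕ → ℤ → ℤ → Set
Collision n x w = x ≢ w × ℤ.+ 1 ℤ.≤ x × ℤ.+ 1 ℤ.≤ w
  × ℤ.+ 2 ℤ.* x ℤ.≤ ℤ.+ (n + 1) × ℤ.+ 2 ℤ.* w ℤ.≤ ℤ.+ (n + 1)
  × (+ n) ∣ (x ℤ.* (ℤ.+ (n + 1) ℤ.- x) ℤ.- w ℤ.* (ℤ.+ (n + 1) ℤ.- w))

odd-divisor : ∀ {n} p → p ℕD.∣ n → ¬ (2 ℕD.∣ n) → ∃ λ a → p ≡ 1 + a * 2
odd-divisor p p∣n n-odd with p % 2 in p%2≡ | m%n<n p 2
... | 0 | _ = ⊥-elim (n-odd (ℕD.∣-trans (ℕD.m%n≡0⇒n∣m p 2 p%2≡) p∣n))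
... | 1 | _ = p / 2 , trans (m≡m%n+[m/n]*n p 2) (cong (_+ p / 2 * 2) p%2≡)
... | suc (suc _) | s≤s (s≤s ())

half-positive : ∀ {a} → 3 ≤ 1 + a * 2 → 1 ≤ a
half-positive {zero}  (s≤s ())
half-positive {suc a} _ = s≤s z≤n

gap-identity : ∀ (W P R : ℤ) → let M = (W ℤ.+ P) ℤ.+ W ℤ.+ R in
  (W ℤ.+ P) ℤ.* (M ℤ.- (W ℤ.+ P)) ℤ.- W ℤ.* (M ℤ.- W) ≡ P ℤ.* R
gap-identity = ℤ-solve-∀

collision-difference : ∀ n p r w → n ≡ p * r → n + 1 ≡ (w + p) + w + r →
  let x = w + p in
  + x ℤ.* (+ (n + 1) ℤ.- + x) ℤ.- + w ℤ.* (+ (n + 1) ℤ.- + w) ≡ + n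
collision-difference n p r w n≡pr n+1≡ = begin
    + (w + p) ℤ.* (+ (n + 1) ℤ.- + (w + p)) ℤ.- + w ℤ.* (+ (n + 1) ℤ.- + w)
      ≡⟨ cong₂ (λ X M → X ℤ.* (M ℤ.- X) ℤ.- + w ℤ.* (M ℤ.- + w)) x≡ m≡ ⟩
    (+ w ℤ.+ + p) ℤ.* (M ℤ.- (+ w ℤ.+ + p)) ℤ.- + w ℤ.* (M ℤ.- + w)
      ≡⟨ gap-identity (+ w) (+ p) (+ r) ⟩
    + p ℤ.* + r
      ≡⟨ sym (ℤP.pos-* p r) ⟩
    + (p * r)
      ≡⟨ cong +_ (sym n≡pr) ⟩
    + n ∎
  where
  open ≡-Reasoning
  M : ℤ
  M = (+ w ℤ.+ + p) ℤ.+ + w ℤ.+ + r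
  x≡ : + (w + p) ≡ + w ℤ.+ + p
  x≡ = ℤP.pos-+ w p
  m≡ : + (n + 1) ≡ M
  m≡ = begin
    + (n + 1)                   ≡⟨ cong +_ n+1≡ ⟩
    + (w + p + w + r)           ≡⟨ ℤP.pos-+ (w + p + w) r ⟩
    + (w + p + w) ℤ.+ + r       ≡⟨ cong (ℤ._+ + r) (ℤP.pos-+ (w + p) w) ⟩
    + (w + p) ℤ.+ + w ℤ.+ + r   ≡⟨ cong (λ X → X ℤ.+ + w ℤ.+ + r) x≡ ⟩
    M                           ∎

collision-from-factors : ∀ n p r w → n ≡ p * r → n + 1 ≡ (w + p) + w + r →
  1 ≤ w → 1 ≤ p → p ≤ r → Collision n (+ (w + p)) (+ w)
collision-from-factors n p r w n≡pr n+1≡ 1≤w 1≤p p≤r =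
  distinct , +≤+ (ℕP.≤-trans 1≤w (ℕP.m≤m+n w p)) , +≤+ 1≤w ,
  double-bound {x} 2x≤n+1 , double-bound {w} 2w≤n+1 , divides
  where
  x : ℕ
  x = w + p

  distinct : + x ≢ + w
  distinct x≡w = ℕP.<⇒≢ (ℕP.m<m+n w 1≤p) (sym (ℤP.+-injective x≡w))

  2x≤n+1 : 2 * x ≤ n + 1
  2x≤n+1 = begin
    2 * x         ≡⟨ double-split w p ⟩
    x + w + p     ≤⟨ ℕP.+-monoʳ-≤ (x + w) p≤r ⟩
    x + w + r     ≡⟨ sym n+1≡ ⟩
    n + 1         ∎
    where
    open ℕP.≤-Reasoning
    -- 2x = x + (w + p), rebracketed to expose the summand p to be enlarged to r.
    double-split : ∀ w p → 2 * (w + p) ≡ (w + p) + w + p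
    double-split = ℕ-solve-∀

  2w≤n+1 : 2 * w ≤ n + 1
  2w≤n+1 = ℕP.≤-trans (ℕP.*-monoʳ-≤ 2 (ℕP.m≤m+n w p)) 2x≤n+1

  double-bound : ∀ {k} → 2 * k ≤ n + 1 → ℤ.+ 2 ℤ.* + k ℤ.≤ + (n + 1)
  double-bound {k} 2k≤ = subst (ℤ._≤ + (n + 1)) (ℤP.pos-* 2 k) (+≤+ 2k≤)

  divides : (+ n) ∣ (+ x ℤ.* (+ (n + 1) ℤ.- + x) ℤ.- + w ℤ.* (+ (n + 1) ℤ.- + w))
  divides = subst ((+ n) ∣_) (sym (collision-difference n p r w n≡pr n+1≡)) ℕD.∣-refl

odd-product-split : ∀ a b → let w = a * b * 2 in
  (1 + a * 2) * (1 + b * 2) + 1 ≡ (w + (1 + a * 2)) + w + (1 + b * 2)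
odd-product-split = ℕ-solve-∀

collision-ordered : ∀ n p r → n ≡ p * r → 3 ≤ p → 3 ≤ r → ¬ (2 ℕD.∣ n) → p ≤ r →
  ∃₂ λ x w → Collision n x w
collision-ordered n p r n≡pr 3≤p 3≤r n-odd p≤r
  with odd-divisor p (ℕD.divides r (trans n≡pr (ℕP.*-comm p r))) n-odd
     | odd-divisor r (ℕD.divides p n≡pr) n-odd
... | a , refl | b , refl =
  + (w + p) , + w ,
  collision-from-factors n p r w n≡pr n+1≡ 1≤w (ℕP.≤-trans (s≤s z≤n) 3≤p) p≤r
  where
  w : ℕ
  w = a * b * 2

  1≤w : 1 ≤ w
  1≤w = ℕP.*-mono-≤ (ℕP.*-mono-≤ (half-positive {a} 3≤p) (half-positive {b} 3≤r)) (s≤s z≤n)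

  n+1≡ : n + 1 ≡ (w + p) + w + r
  n+1≡ = trans (cong (_+ 1) n≡pr) (odd-product-split a b)

mainTheorem7 : (n p r : ℕ) → n ≡ p * r → 3 ≤ p → 3 ≤ r → ¬ (2 ℕD.∣ n) →
    ∃₂ λ (x w : ℤ) → x ≢ w × ℤ.+ 1 ℤ.≤ x × ℤ.+ 1 ℤ.≤ w
    × ℤ.+ 2 ℤ.* x ℤ.≤ ℤ.+ (n + 1) × ℤ.+ 2 ℤ.* w ℤ.≤ ℤ.+ (n + 1)
    × (+ n) ∣ (x ℤ.* (ℤ.+ (n + 1) ℤ.- x) ℤ.- w ℤ.* (ℤ.+ (n + 1) ℤ.- w))
mainTheorem7 n p r n≡pr 3≤p 3≤r n-odd with ℕP.≤-total p r
... | inj₁ p≤r = collision-ordered n p r n≡pr 3≤p 3≤r n-odd p≤r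
... | inj₂ r≤p = collision-ordered n r p (trans n≡pr (ℕP.*-comm p r)) 3≤r 3≤p n-odd r≤p
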